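{- Let $\Bbbk$ be a field of characteristic different from $2$ and $n\ge0$. As $F$ runs over the sparse subsets of $[n-1]$, the elements $O_F$ form a linear basis of $\mathfrak{P}_n$, and so do the elements $\bar O_F$.
   Context: $[n]=\{1,\dots,n\}$, $J+i=\{x+i:x\in J\}$. A set of integers is sparse if it contains no two consecutive integers. For $\sigma\in S_n$, $\sigma(0)=0$ and $\mathrm{Peak}(\sigma)=\{i\in[n-1]:\sigma(i-1)<\sigma(i)>\sigma(i+1)\}$. For sparse $F\subseteq[n-1]$, $P_F=\sum_{\mathrm{Peak}(\sigma)=F}\sigma\in\Bbbk S_n$; the peak algebra $\mathfrak{P}_n$ is the span of the $P_F$. For sparse $F$: $\bar F=F\cup((F-1)\cap(F+1))$, $O_F=\sum_{G\subseteq[n-1]\setminus F}P_G$, $\bar O_F=\sum_{G\subseteq[n-1]\setminus\bar F}P_G$, sums over sparse $G\subseteq[n-1]$. -}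

module Defs where

open import Level using (Level; _⊔_) renaming (suc to lsuc)
open import Data.Bool using (Bool; true; false; _∧_; _∨_; not; if_then_else_)
open import Data.Nat using (ℕ; zero; suc; _∸_; _<ᵇ_; _<_)
open import Data.Nat.Properties using (_<?_)
open import Data.Fin using (Fin; toℕ; fromℕ<)
open import Data.Vec using (Vec; []; _∷_; tabulate; lookup)
open import Data.Fin.Permutation using (Permutation′; _⟨$⟩ʳ_)
open import Data.Product using (Σ; ∃; _×_)
open import Relation.Nullary using (¬_; yes; no)
open import Algebra.Bundles using (CommutativeRing)
open import Relation.Binary.PropositionalEquality using (_≡_)

record Field (c ℓ : Level) : Set (lsuc (c ⊔ ℓ)) where
  field
    commutativeRing : CommutativeRing c ℓ
  open CommutativeRing commutativeRing public
  field
    0≉1     : ¬ (0# ≈ 1#)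
    inverse : ∀ x → ¬ (x ≈ 0#) → Σ Carrier λ y → x * y ≈ 1#

CharNot2 : ∀ {c ℓ} → Field c ℓ → Set ℓ
CharNot2 K = ¬ ((1# + 1#) ≈ 0#)
  where open Field K

-- Subsets of [n-1] = {1,…,n-1} are encoded as  Vec Bool (n ∸ 1):
-- entry number j (0-based) says whether the integer j+1 belongs to it.

Sub : ℕ → Set
Sub n = Vec Bool (n ∸ 1)

memV : ∀ {m} → Vec Bool m → ℕ → Bool
memV v zero = false
memV {m} v (suc k) with k <? m
... | yes k<m = lookup v (fromℕ< k<m)
... | no  _   = false

sparse : ∀ {m} → Vec Bool m → Bool
sparse []                  = true
sparse (b ∷ [])            = true
sparse (b ∷ (b' ∷ v))      = not (b ∧ b') ∧ sparse (b' ∷ v)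

eqV : ∀ {m} → Vec Bool m → Vec Bool m → Bool
eqV []      []        = true
eqV (a ∷ v) (b ∷ w)   = (if a then b else not b) ∧ eqV v w

disjoint : ∀ {m} → Vec Bool m → Vec Bool m → Bool
disjoint []      []      = true
disjoint (a ∷ v) (b ∷ w) = not (a ∧ b) ∧ disjoint v w

-- F̄ = F ∪ ((F - 1) ∩ (F + 1)), intersected with [n-1]
-- (x ∈ F - 1 iff x + 1 ∈ F ;  x ∈ F + 1 iff x - 1 ∈ F)
bar : ∀ {m} → Vec Bool m → Vec Bool m
bar {m} F = tabulate λ j →
  let x = suc (toℕ j) in memV F x ∨ (memV F (suc x) ∧ memV F (x ∸ 1))

-- Peak sets. For σ ∈ S_n (permutation of Fin n, Fin index i encoding the
-- integer i+1), the extended values σ̂ : ℕ → ℕ with σ̂(0) = 0 and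
-- σ̂(i) = σ(i) ∈ [n] for 1 ≤ i ≤ n.

σ̂ : ∀ {n} → Permutation′ n → ℕ → ℕ
σ̂ σ zero = zero
σ̂ {n} σ (suc k) with k <? n
... | yes k<n = suc (toℕ (σ ⟨$⟩ʳ fromℕ< k<n))
... | no  _   = zero

Peak : ∀ {n} → Permutation′ n → Sub n
Peak σ = tabulate λ j →
  let i = suc (toℕ j) in (σ̂ σ (i ∸ 1) <ᵇ σ̂ σ i) ∧ (σ̂ σ (suc i) <ᵇ σ̂ σ i)

-- Linear algebra over a field K in the group algebra K S_n.
-- An element of K S_n is its coefficient function S_n → K;
-- equality is pointwise.

module GroupAlgebra {c ℓ} (K : Field c ℓ) where
  open Field K

  KS : ℕ → Set c
  KS n = Permutation′ n → Carrier

  _≋_ : ∀ {n} → KS n → KS n → Set ℓ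
  x ≋ y = ∀ σ → x σ ≈ y σ

  ⟦_⟧ : Bool → Carrier
  ⟦ b ⟧ = if b then 1# else 0#

  sumV : (m : ℕ) → (Vec Bool m → Carrier) → Carrier
  sumV zero    f = f []
  sumV (suc m) f = sumV m (λ v → f (false ∷ v)) + sumV m (λ v → f (true ∷ v))

  P : ∀ {n} → Sub n → KS n
  P F σ = ⟦ eqV (Peak σ) F ⟧

  O : ∀ {n} → Sub n → KS n
  O {n} F σ = sumV (n ∸ 1) λ G → ⟦ sparse G ∧ disjoint G F ⟧ * P G σ

  Ō : ∀ {n} → Sub n → KS n
  Ō F = O (bar F)

  comb : ∀ {n} → (Sub n → Carrier) → (Sub n → KS n) → KS n
  comb {n} coef b σ = sumV (n ∸ 1) λ F → if sparse F then coef F * b F σ else 0#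

  InPeakAlgebra : ∀ {n} → KS n → Set (c ⊔ ℓ)
  InPeakAlgebra {n} x = Σ (Sub n → Carrier) λ coef → x ≋ comb coef P

  IsPeakBasis : ∀ {n} → (Sub n → KS n) → Set (c ⊔ ℓ)
  IsPeakBasis {n} b =
      (∀ F → sparse F ≡ true → InPeakAlgebra (b F))
    × (∀ (coef : Sub n → Carrier) → comb coef b ≋ (λ _ → 0#) →
         ∀ F → sparse F ≡ true → coef F ≈ 0#)
    × (∀ x → InPeakAlgebra x →
         Σ (Sub n → Carrier) λ coef → x ≋ comb coef b)

{-# OPTIONS --safe #-}
-- Evaluating at a permutation σ gives O_Y(σ) = [Peak(σ) ∩ Y = ∅], and every sparse set is
-- the peak set of some permutation (a product of disjoint adjacent transpositions). Hence, for
-- X(F) = F or X(F) = F̄, the O_{X(F)} form a basis of 𝔓_n as soon as the matrix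
-- D_{F,H} = [H ∩ X(F) = ∅] indexed by sparse sets has a left inverse and independent rows.
-- By inclusion–exclusion
--   D_{F,H} = Σ_{F′} [F′ ⊆ X(F)] (-1)^{|F′|} [F′ ⊆ H],
-- where F′ may be restricted to sparse sets because subsets of the sparse set H are sparse.
-- The second factor is unitriangular for inclusion; the first is triangular with diagonal ±1
-- for the lexicographic order, since a sparse subset of X(F) other than F is lexicographically
-- smaller than F.
module Submission where

open import Defs
open import Level using (_⊔_)
open import Algebra.Bundles using (CommutativeRing)
open import Data.Bool using (Bool; true; false; _∧_; _∨_; not; if_then_else_; T)
open import Data.Nat as ℕ
  using (ℕ; zero; suc; pred; _∸_; _^_; _<ᵇ_; _<_; _≤_; z≤n; s≤s; z<s; s<s)
import Data.Nat.Properties as ℕₚ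
open import Data.Fin using (Fin; toℕ; fromℕ<) renaming (zero to fzero; suc to fsuc)
open import Data.Vec using (Vec; []; _∷_; tabulate; lookup)
open import Data.Vec.Properties using (tabulate∘lookup; tabulate-cong; ∷-injectiveʳ)
open import Data.Fin.Permutation using (Permutation′; permutation)
open import Data.Product using (Σ; _×_; _,_; proj₁; proj₂; uncurry)
open import Data.Sum using (_⊎_; inj₁; inj₂)
open import Function using (_∘_)
open import Relation.Nullary using (yes; no; contradiction)
import Relation.Binary.PropositionalEquality as ≡
open ≡ using (_≡_; _≢_)

module BooleanVectors where
  open ≡
  open import Data.Nat using (_+_)
  open import Data.Bool.Properties using (∧-zeroʳ; ∧-conicalˡ; ∧-conicalʳ; ∨-identityʳ)
  open ℕₚ using (_<?_; +-monoʳ-<; <-≤-trans; m≤m+n)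
  open import Data.Fin.Properties using (toℕ<n; fromℕ<-toℕ)

  Sparse : ∀ {m} → Vec Bool m → Set
  Sparse v = sparse v ≡ true

  memV-[] : ∀ x → memV [] x ≡ false
  memV-[] zero    = refl
  memV-[] (suc k) with k <? 0
  ... | no _ = refl

  memV-head : ∀ {m} b (v : Vec Bool m) → memV (b ∷ v) 1 ≡ b
  memV-head {m} b v with 0 <? suc m
  ... | yes _    = refl
  ... | no 0≮1+m = contradiction z<s 0≮1+m

  memV-tail : ∀ {m} b (v : Vec Bool m) k → memV (b ∷ v) (suc (suc k)) ≡ memV v (suc k)
  memV-tail {m} b v k with suc k <? suc m | k <? m
  ... | yes _         | yes _   = refl
  ... | yes (s≤s k<m) | no k≮m  = contradiction k<m k≮m
  ... | no 1+k≮1+m    | yes k<m = contradiction (s<s k<m) 1+k≮1+m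
  ... | no _          | no _    = refl

  memV-lookup : ∀ {m} (v : Vec Bool m) (j : Fin m) → memV v (suc (toℕ j)) ≡ lookup v j
  memV-lookup {m} v j with toℕ j <? m
  ... | yes j<m = cong (lookup v) (fromℕ<-toℕ j j<m)
  ... | no j≮m  = contradiction (toℕ<n j) j≮m

  memV⇒bounds : ∀ {m} (v : Vec Bool m) x → memV v x ≡ true → 1 ≤ x × x ≤ m
  memV⇒bounds {m} v (suc k) _ with k <? m
  ... | yes k<m = s≤s z≤n , k<m

  sparse-tail : ∀ {m} b (v : Vec Bool m) → Sparse (b ∷ v) → Sparse v
  sparse-tail b []      _ = refl
  sparse-tail b (c ∷ v) s = ∧-conicalʳ _ _ s

  sparse-head : ∀ {m} b c (v : Vec Bool m) → Sparse (b ∷ c ∷ v) → b ∧ c ≡ false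
  sparse-head true  true  v ()
  sparse-head true  false v _ = refl
  sparse-head false c     v _ = refl

  sparse⇒¬consecutive : ∀ {m} (v : Vec Bool m) → Sparse v →
    ∀ x → memV v x ∧ memV v (suc x) ≡ false
  sparse⇒¬consecutive v _ zero = refl
  sparse⇒¬consecutive [] _ (suc k) rewrite memV-[] (suc k) = refl
  sparse⇒¬consecutive (b ∷ []) _ 1
    rewrite memV-head b [] | memV-tail b [] 0 | memV-[] 1 = ∧-zeroʳ b
  sparse⇒¬consecutive (b ∷ c ∷ v) s 1
    rewrite memV-head b (c ∷ v) | memV-tail b (c ∷ v) 0 | memV-head c v = sparse-head b c v s
  sparse⇒¬consecutive (b ∷ v) s (suc (suc k))
    rewrite memV-tail b v k | memV-tail b v (suc k) =
      sparse⇒¬consecutive v (sparse-tail b v s) (suc k)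

  sparse-tabulate : ∀ m (g : ℕ → Bool) → (∀ t → g t ∧ g (suc t) ≡ false) →
    Sparse (tabulate {n = m} (λ j → g (toℕ j)))
  sparse-tabulate zero          g _         = refl
  sparse-tabulate (suc zero)    g _         = refl
  sparse-tabulate (suc (suc m)) g g-sparse =
    cong₂ _∧_ (cong not (g-sparse 0)) (sparse-tabulate (suc m) (g ∘ suc) (g-sparse ∘ suc))

  eqV-refl : ∀ {m} (v : Vec Bool m) → eqV v v ≡ true
  eqV-refl []          = refl
  eqV-refl (true ∷ v)  = eqV-refl v
  eqV-refl (false ∷ v) = eqV-refl v

  eqV⇒≡ : ∀ {m} (v w : Vec Bool m) → eqV v w ≡ true → v ≡ w
  eqV⇒≡ []          []          _ = refl
  eqV⇒≡ (true ∷ v)  (true ∷ w)  e = cong (true ∷_) (eqV⇒≡ v w e)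
  eqV⇒≡ (false ∷ v) (false ∷ w) e = cong (false ∷_) (eqV⇒≡ v w e)

  ≢⇒eqV≡false : ∀ {m} (v w : Vec Bool m) → v ≢ w → eqV v w ≡ false
  ≢⇒eqV≡false v w v≢w with eqV v w in e
  ... | true  = contradiction (eqV⇒≡ v w e) v≢w
  ... | false = refl

  eqV≡false⇒≢ : ∀ {m} (v w : Vec Bool m) → eqV v w ≡ false → v ≢ w
  eqV≡false⇒≢ v w e refl = contradiction (trans (sym e) (eqV-refl v)) λ ()

  _⊆ᵇ_ : ∀ {m} → Vec Bool m → Vec Bool m → Bool
  []      ⊆ᵇ []      = true
  (a ∷ v) ⊆ᵇ (b ∷ w) = (not a ∨ b) ∧ (v ⊆ᵇ w)

  _⊆_ : ∀ {m} → Vec Bool m → Vec Bool m → Set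
  v ⊆ w = v ⊆ᵇ w ≡ true

  ⊆-refl : ∀ {m} (v : Vec Bool m) → v ⊆ v
  ⊆-refl []          = refl
  ⊆-refl (true ∷ v)  = ⊆-refl v
  ⊆-refl (false ∷ v) = ⊆-refl v

  ⊆-sparse : ∀ {m} (v w : Vec Bool m) → v ⊆ w → Sparse w → Sparse v
  ⊆-sparse []           []           _   _        = refl
  ⊆-sparse (_ ∷ [])     (_ ∷ [])     _   _        = refl
  ⊆-sparse (a ∷ a′ ∷ v) (b ∷ b′ ∷ w) v⊆w w-sparse =
    cong₂ _∧_ (heads a a′ b b′ (∧-conicalˡ _ _ v⊆w) (∧-conicalˡ _ _ tail⊆)
                              (∧-conicalˡ _ _ w-sparse))
              (⊆-sparse (a′ ∷ v) (b′ ∷ w) tail⊆ (∧-conicalʳ _ _ w-sparse))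
    where
    tail⊆ = ∧-conicalʳ (not a ∨ b) _ v⊆w
    heads : ∀ a a′ b b′ → not a ∨ b ≡ true → not a′ ∨ b′ ≡ true →
      not (b ∧ b′) ≡ true → not (a ∧ a′) ≡ true
    heads false _     _     _     _  _  _  = refl
    heads true  false _     _     _  _  _  = refl
    heads true  true  false _     () _  _
    heads true  true  true  false _  () _
    heads true  true  true  true  _  _  ()

  lex : ∀ {m} → Vec Bool m → ℕ
  lex []              = 0
  lex {suc m} (b ∷ v) = (if b then 2 ^ m else 0) + lex v

  lex<2^ : ∀ {m} (v : Vec Bool m) → lex v < 2 ^ m
  lex<2^ []              = s≤s z≤n
  lex<2^ {suc m} (true ∷ v)  = +-monoʳ-< (2 ^ m) (<-≤-trans (lex<2^ v) (m≤m+n (2 ^ m) 0))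
  lex<2^ {suc m} (false ∷ v) = <-≤-trans (lex<2^ v) (m≤m+n (2 ^ m) _)

  lex-false<true : ∀ {m} (v w : Vec Bool m) → lex (false ∷ v) < lex (true ∷ w)
  lex-false<true {m} v w = <-≤-trans (lex<2^ v) (m≤m+n (2 ^ m) _)

  lex-∷ : ∀ {m} b (v w : Vec Bool m) → lex v < lex w → lex (b ∷ v) < lex (b ∷ w)
  lex-∷ b v w lv<lw = +-monoʳ-< _ lv<lw

  ⊂⇒lex< : ∀ {m} (v w : Vec Bool m) → v ⊆ w → v ≢ w → lex v < lex w
  ⊂⇒lex< []          []          _   v≢w = contradiction refl v≢w
  ⊂⇒lex< (true ∷ v)  (true ∷ w)  v⊆w v≢w =
    lex-∷ true v w (⊂⇒lex< v w v⊆w (v≢w ∘ cong (true ∷_)))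
  ⊂⇒lex< (false ∷ v) (false ∷ w) v⊆w v≢w =
    lex-∷ false v w (⊂⇒lex< v w v⊆w (v≢w ∘ cong (false ∷_)))
  ⊂⇒lex< (false ∷ v) (true ∷ w)  _   _   = lex-false<true v w

  -- barFrom p v is bar v computed as if v were preceded by an entry p
  barFrom : ∀ {m} → Bool → Vec Bool m → Vec Bool m
  barFrom p []          = []
  barFrom p (b ∷ [])    = b ∷ []
  barFrom p (b ∷ c ∷ v) = (b ∨ (c ∧ p)) ∷ barFrom b (c ∷ v)

  memV-false∷ : ∀ {m} (v : Vec Bool m) x → memV (false ∷ v) (suc x) ≡ memV v x
  memV-false∷ v zero    = memV-head false v
  memV-false∷ v (suc k) = memV-tail false v k

  lookup-barFrom : ∀ {m} p (v : Vec Bool m) (j : Fin m) → let t = toℕ j in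
    lookup (barFrom p v) j ≡
      memV (p ∷ v) (2 + t) ∨ (memV (p ∷ v) (3 + t) ∧ memV (p ∷ v) (1 + t))
  lookup-barFrom p (b ∷ []) fzero
    rewrite memV-tail p (b ∷ []) 0 | memV-tail p (b ∷ []) 1 | memV-head p (b ∷ [])
          | memV-head b [] | memV-tail b [] 0 | memV-[] 1 = sym (∨-identityʳ b)
  lookup-barFrom p (b ∷ c ∷ v) fzero
    rewrite memV-tail p (b ∷ c ∷ v) 0 | memV-tail p (b ∷ c ∷ v) 1 | memV-head p (b ∷ c ∷ v)
          | memV-head b (c ∷ v) | memV-tail b (c ∷ v) 0 | memV-head c v = refl
  lookup-barFrom p (b ∷ c ∷ v) (fsuc j)
    rewrite memV-tail p (b ∷ c ∷ v) (suc (toℕ j))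
          | memV-tail p (b ∷ c ∷ v) (suc (suc (toℕ j)))
          | memV-tail p (b ∷ c ∷ v) (toℕ j) = lookup-barFrom b (c ∷ v) j

  bar≡barFrom : ∀ {m} (v : Vec Bool m) → bar v ≡ barFrom false v
  bar≡barFrom v = trans (tabulate-cong entry) (tabulate∘lookup (barFrom false v))
    where
    entry : ∀ j → _ ≡ lookup (barFrom false v) j
    entry j = sym (trans (lookup-barFrom false v j)
                         (cong₂ _∨_ (memV-false∷ v (suc t))
                                    (cong₂ _∧_ (memV-false∷ v (suc (suc t))) (memV-false∷ v t))))
      where t = toℕ j

  ⊆-barFrom : ∀ {m} p (v : Vec Bool m) → v ⊆ barFrom p v
  ⊆-barFrom p []              = refl
  ⊆-barFrom p (true ∷ [])     = refl
  ⊆-barFrom p (false ∷ [])    = refl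
  ⊆-barFrom p (true ∷ c ∷ v)  = ⊆-barFrom true (c ∷ v)
  ⊆-barFrom p (false ∷ c ∷ v) = ⊆-barFrom false (c ∷ v)

  -- At the first entry x where u and v differ, x ∈ u ∖ v would force x - 1 ∈ v (by the
  -- definition of bar), hence x - 1 ∈ u, contradicting sparsity; p is the entry before both.
  ⊆-barFrom⇒lex< : ∀ {m} p (u v : Vec Bool m) → Sparse (p ∷ u) → u ⊆ barFrom p v →
    u ≢ v → lex u < lex v
  ⊆-barFrom⇒lex< p []           []           _ _ u≢v = contradiction refl u≢v
  ⊆-barFrom⇒lex< p (true ∷ [])  (true ∷ [])  _ _ u≢v = contradiction refl u≢v
  ⊆-barFrom⇒lex< p (false ∷ []) (false ∷ []) _ _ u≢v = contradiction refl u≢v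
  ⊆-barFrom⇒lex< p (false ∷ []) (true ∷ [])  _ _ _   = lex-false<true [] []
  ⊆-barFrom⇒lex< p (false ∷ u)  (true ∷ c ∷ v) _ _ _ = lex-false<true u (c ∷ v)
  ⊆-barFrom⇒lex< p (true ∷ u)   (true ∷ c ∷ v) p∷u-sparse u⊆ u≢v =
    lex-∷ true u (c ∷ v) (⊆-barFrom⇒lex< true u (c ∷ v) (sparse-tail p (true ∷ u) p∷u-sparse)
                                          u⊆ (u≢v ∘ cong (true ∷_)))
  ⊆-barFrom⇒lex< p (false ∷ u)  (false ∷ c ∷ v) p∷u-sparse u⊆ u≢v =
    lex-∷ false u (c ∷ v) (⊆-barFrom⇒lex< false u (c ∷ v) (sparse-tail p (false ∷ u) p∷u-sparse)
                                           u⊆ (u≢v ∘ cong (false ∷_)))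
  ⊆-barFrom⇒lex< p (true ∷ u)   (false ∷ c ∷ v) p∷u-sparse u⊆ _ =
    contradiction (subst (λ q → Sparse (q ∷ true ∷ u)) p≡true p∷u-sparse) λ ()
    where
    p≡true = ∧-conicalʳ c p (∧-conicalˡ _ _ u⊆)

  sparse-false∷ : ∀ {m} (v : Vec Bool m) → sparse (false ∷ v) ≡ sparse v
  sparse-false∷ []      = refl
  sparse-false∷ (_ ∷ _) = refl

  ⊆-bar : ∀ {m} (v : Vec Bool m) → v ⊆ bar v
  ⊆-bar v = subst (v ⊆_) (sym (bar≡barFrom v)) (⊆-barFrom false v)

  ⊆-bar⇒lex< : ∀ {m} (u v : Vec Bool m) → Sparse u → u ⊆ bar v → u ≢ v → lex u < lex v
  ⊆-bar⇒lex< u v u-sparse u⊆ =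
    ⊆-barFrom⇒lex< false u v (trans (sparse-false∷ u) u-sparse) (subst (u ⊆_) (bar≡barFrom v) u⊆)

  record LexMaximal {m} (X : Vec Bool m → Vec Bool m) : Set where
    field
      ⊆-image             : ∀ F → F ⊆ X F
      sparse-⊆-image⇒lex< : ∀ F F′ → Sparse F′ → F′ ⊆ X F → F′ ≢ F → lex F′ < lex F

  id-lexMaximal : ∀ {m} → LexMaximal {m} (λ F → F)
  id-lexMaximal = record
    { ⊆-image             = ⊆-refl
    ; sparse-⊆-image⇒lex< = λ F F′ _ F′⊆F → ⊂⇒lex< F′ F F′⊆F
    }

  bar-lexMaximal : ∀ {m} → LexMaximal {m} bar
  bar-lexMaximal = record
    { ⊆-image             = ⊆-bar
    ; sparse-⊆-image⇒lex< = λ F F′ F′-sparse → ⊆-bar⇒lex< F′ F F′-sparse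
    }

open BooleanVectors

module PeakSets where
  open ≡
  open ≡-Reasoning
  open import Data.Unit using (tt)
  open import Data.Bool.Properties using (∧-zeroʳ; T-≡)
  open import Function.Bundles using (Equivalence)
  open import Data.Fin.Properties using (toℕ-injective; toℕ<n; toℕ-fromℕ<)
  import Data.Fin.Permutation as Permutation
  open import Data.Nat using (_+_)
  open ℕₚ using (_<?_; ≤-refl; m≤n+m; ≤-trans; n≤1+n; m<n⇒m≤1+n; pred-mono-≤; pred[n]≤n;
                 <⇒≤; <⇒<ᵇ; <ᵇ⇒<; ≤⇒≯; suc-injective)

  <⇒<ᵇ≡true : ∀ {m n} → m < n → (m <ᵇ n) ≡ true
  <⇒<ᵇ≡true m<n = Equivalence.to T-≡ (<⇒<ᵇ m<n)

  ≥⇒<ᵇ≡false : ∀ {m n} → n ≤ m → (m <ᵇ n) ≡ false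
  ≥⇒<ᵇ≡false {m} {n} n≤m with m <ᵇ n in eq
  ... | false = refl
  ... | true  = contradiction (<ᵇ⇒< m n (subst T (sym eq) tt)) (≤⇒≯ n≤m)

  shift : Bool → Bool → ℕ → ℕ
  shift true  _     x = suc x
  shift false true  x = pred x
  shift false false x = x

  -- The product of the disjoint transpositions (x x+1), x ∈ G, as a map on ℕ; on
  -- {1, …, m + 1} it is the permutation with peak set G.
  swapAt : ∀ {m} → Vec Bool m → ℕ → ℕ
  swapAt G x = shift (memV G x) (memV G (pred x)) x

  -- a, b, c, d stand for t ∈ G, t + 1 ∈ G, t + 2 ∈ G, t - 1 ∈ G
  shift-peak : ∀ a b c d t → a ∧ b ≡ false → b ∧ c ≡ false →
    (shift a d t <ᵇ shift b a (suc t)) ∧ (shift c b (suc (suc t)) <ᵇ shift b a (suc t)) ≡ b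
  shift-peak true  true  _     _     _ ()
  shift-peak _     true  true  _     _ _ ()
  shift-peak false true  false true  t _ _ =
    cong₂ _∧_ (<⇒<ᵇ≡true {pred t} (s≤s (≤-trans (pred[n]≤n {t}) (n≤1+n t))))
              (<⇒<ᵇ≡true {suc t} ≤-refl)
  shift-peak false true  false false t _ _ =
    cong₂ _∧_ (<⇒<ᵇ≡true {t} (s≤s (n≤1+n t))) (<⇒<ᵇ≡true {suc t} ≤-refl)
  shift-peak true  false c     d     t _ _ =
    cong (_∧ (shift c false (suc (suc t)) <ᵇ t)) (≥⇒<ᵇ≡false {suc t} (n≤1+n t))
  shift-peak false false true  d     t _ _ =
    trans (cong ((shift false d t <ᵇ suc t) ∧_) (≥⇒<ᵇ≡false {3 + t} (m≤n+m (suc t) 2)))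
          (∧-zeroʳ _)
  shift-peak false false false d     t _ _ =
    trans (cong ((shift false d t <ᵇ suc t) ∧_) (≥⇒<ᵇ≡false {2 + t} (n≤1+n (suc t))))
          (∧-zeroʳ _)

  swapAt-involutive : ∀ {m} (G : Vec Bool m) → Sparse G → ∀ x → swapAt G (swapAt G x) ≡ x
  swapAt-involutive G G-sparse x with memV G x in x∈G
  ... | true
    rewrite subst (λ a → a ∧ memV G (suc x) ≡ false) x∈G (sparse⇒¬consecutive G G-sparse x)
          | x∈G = refl
  swapAt-involutive G G-sparse zero    | false = refl
  swapAt-involutive G G-sparse (suc y) | false with memV G y in y∈G
  ... | true  rewrite y∈G = refl
  ... | false rewrite x∈G | y∈G = refl

  swapAt-bounds : ∀ {m} (G : Vec Bool m) x → 1 ≤ x → x ≤ suc m →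
    1 ≤ swapAt G x × swapAt G x ≤ suc m
  swapAt-bounds G x 1≤x x≤1+m with memV G x in x∈G
  ... | true = s≤s z≤n , s≤s (proj₂ (memV⇒bounds G x x∈G))
  ... | false with memV G (pred x) in x-1∈G
  ...   | true  = proj₁ (memV⇒bounds G (pred x) x-1∈G) ,
                  ≤-trans (pred-mono-≤ x≤1+m) (n≤1+n _)
  ...   | false = 1≤x , x≤1+m

  module SwapPermutation {m} (G : Vec Bool m) (G-sparse : Sparse G) where

    positive-bounded : ∀ {y} → 1 ≤ y → y ≤ suc m → Σ (Fin (suc m)) λ j → suc (toℕ j) ≡ y
    positive-bounded {suc k} _ k<1+m = fromℕ< k<1+m , cong suc (toℕ-fromℕ< k<1+m)

    swapFin-spec : (i : Fin (suc m)) →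
      Σ (Fin (suc m)) λ j → suc (toℕ j) ≡ swapAt G (suc (toℕ i))
    swapFin-spec i =
      uncurry positive-bounded (swapAt-bounds G (suc (toℕ i)) (s≤s z≤n) (toℕ<n i))

    swapFin : Fin (suc m) → Fin (suc m)
    swapFin i = proj₁ (swapFin-spec i)

    swapFin-involutive : ∀ i → swapFin (swapFin i) ≡ i
    swapFin-involutive i = toℕ-injective (suc-injective (begin
      suc (toℕ (swapFin (swapFin i)))       ≡⟨ proj₂ (swapFin-spec (swapFin i)) ⟩
      swapAt G (suc (toℕ (swapFin i)))      ≡⟨ cong (swapAt G) (proj₂ (swapFin-spec i)) ⟩
      swapAt G (swapAt G (suc (toℕ i)))     ≡⟨ swapAt-involutive G G-sparse (suc (toℕ i)) ⟩
      suc (toℕ i)                           ∎))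

    swapPerm : Permutation′ (suc m)
    swapPerm = permutation swapFin swapFin swapFin-involutive swapFin-involutive

    σ̂-swapPerm : ∀ x → x ≤ suc m → σ̂ swapPerm x ≡ swapAt G x
    σ̂-swapPerm zero    _     = refl
    σ̂-swapPerm (suc k) x≤1+m with k <? suc m
    ... | yes k<1+m = trans (proj₂ (swapFin-spec (fromℕ< k<1+m)))
                            (cong (λ y → swapAt G (suc y)) (toℕ-fromℕ< k<1+m))
    ... | no k≮1+m  = contradiction x≤1+m k≮1+m

    Peak-swapPerm : Peak swapPerm ≡ G
    Peak-swapPerm = trans (tabulate-cong peak-at) (tabulate∘lookup G)
      where
      peak-at : (j : Fin m) → _ ≡ lookup G j
      peak-at j = begin
        (σ̂ π t <ᵇ σ̂ π (suc t)) ∧ (σ̂ π (suc (suc t)) <ᵇ σ̂ π (suc t))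
          ≡⟨ cong₂ _∧_ (cong₂ _<ᵇ_ (σ̂-swapPerm t (m<n⇒m≤1+n t<m))
                                    (σ̂-swapPerm (suc t) 1+t≤1+m))
                       (cong₂ _<ᵇ_ (σ̂-swapPerm (suc (suc t)) (s≤s t<m))
                                    (σ̂-swapPerm (suc t) 1+t≤1+m)) ⟩
        (swapAt G t <ᵇ swapAt G (suc t)) ∧ (swapAt G (suc (suc t)) <ᵇ swapAt G (suc t))
          ≡⟨ shift-peak _ _ _ _ t (sparse⇒¬consecutive G G-sparse t)
                                  (sparse⇒¬consecutive G G-sparse (suc t)) ⟩
        memV G (suc t)
          ≡⟨ memV-lookup G j ⟩
        lookup G j ∎
        where
        π = swapPerm
        t = toℕ j
        t<m = toℕ<n j
        1+t≤1+m = ≤-trans t<m (n≤1+n m)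

  Peak-surjective : ∀ n (G : Sub n) → Sparse G → Σ (Permutation′ n) λ σ → Peak σ ≡ G
  Peak-surjective zero    [] _ = Permutation.id , refl
  Peak-surjective (suc m) G G-sparse = swapPerm , Peak-swapPerm
    where open SwapPermutation G G-sparse

  adjacent-peaks : ∀ a b c d → (a ∧ (c <ᵇ b)) ∧ ((b <ᵇ c) ∧ d) ≡ false
  adjacent-peaks a b c d with c <ᵇ b in c<b
  ... | false = cong (_∧ _) (∧-zeroʳ a)
  ... | true rewrite ≥⇒<ᵇ≡false {b} {c} (<⇒≤ (<ᵇ⇒< c b (subst T (sym c<b) tt))) =
    ∧-zeroʳ _

  Peak-sparse : ∀ {n} (σ : Permutation′ n) → Sparse (Peak σ)
  Peak-sparse {n} σ = sparse-tabulate (n ∸ 1) isPeak λ t →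
    adjacent-peaks (σ̂ σ t <ᵇ σ̂ σ (suc t)) (σ̂ σ (suc t)) (σ̂ σ (2 + t))
                   (σ̂ σ (3 + t) <ᵇ σ̂ σ (2 + t))
    where
    isPeak : ℕ → Bool
    isPeak t = (σ̂ σ t <ᵇ σ̂ σ (suc t)) ∧ (σ̂ σ (suc (suc t)) <ᵇ σ̂ σ (suc t))

open PeakSets

module SparseMatrices {c ℓ} (R : CommutativeRing c ℓ) where
  open CommutativeRing R
  open import Relation.Binary.Reasoning.Setoid setoid
  open import Algebra.Properties.Ring ring
    using (-1*x≈-x; [y-z]x≈yx-zx; -0#≈0#; -‿distribˡ-*; -‿distribʳ-*; -‿involutive)
  open import Algebra.Properties.CommutativeSemigroup *-commutativeSemigroup using (x∙yz≈y∙xz)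
  open import Algebra.Properties.CommutativeSemigroup +-commutativeSemigroup using (interchange)

  𝟙 : Bool → Carrier
  𝟙 b = if b then 1# else 0#

  x≈0⇒x*y≈0 : ∀ {x} y → x ≈ 0# → x * y ≈ 0#
  x≈0⇒x*y≈0 y x≈0 = trans (*-cong x≈0 refl) (zeroˡ y)

  y≈0⇒x*y≈0 : ∀ x {y} → y ≈ 0# → x * y ≈ 0#
  y≈0⇒x*y≈0 x y≈0 = trans (*-cong refl y≈0) (zeroʳ x)

  ∑ : ∀ m → (Vec Bool m → Carrier) → Carrier
  ∑ zero    f = f []
  ∑ (suc m) f = ∑ m (λ v → f (false ∷ v)) + ∑ m (λ v → f (true ∷ v))

  ∑-cong : ∀ m {f g : Vec Bool m → Carrier} → (∀ v → f v ≈ g v) → ∑ m f ≈ ∑ m g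
  ∑-cong zero    f≈g = f≈g []
  ∑-cong (suc m) f≈g =
    +-cong (∑-cong m (f≈g ∘ (false ∷_))) (∑-cong m (f≈g ∘ (true ∷_)))

  ∑-zero : ∀ m {f : Vec Bool m → Carrier} → (∀ v → f v ≈ 0#) → ∑ m f ≈ 0#
  ∑-zero zero    f≈0 = f≈0 []
  ∑-zero (suc m) f≈0 =
    trans (+-cong (∑-zero m (f≈0 ∘ (false ∷_))) (∑-zero m (f≈0 ∘ (true ∷_)))) (+-identityˡ 0#)

  ∑-+ : ∀ m (f g : Vec Bool m → Carrier) → ∑ m (λ v → f v + g v) ≈ ∑ m f + ∑ m g
  ∑-+ zero    f g = refl
  ∑-+ (suc m) f g = trans (+-cong (∑-+ m _ _) (∑-+ m _ _)) (interchange _ _ _ _)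

  ∑-*ˡ : ∀ m a (f : Vec Bool m → Carrier) → ∑ m (λ v → a * f v) ≈ a * ∑ m f
  ∑-*ˡ zero    a f = refl
  ∑-*ˡ (suc m) a f = trans (+-cong (∑-*ˡ m a _) (∑-*ˡ m a _)) (sym (distribˡ a _ _))

  ∑-neg : ∀ m (f : Vec Bool m → Carrier) → ∑ m (λ v → - f v) ≈ - ∑ m f
  ∑-neg m f = begin
    ∑ m (λ v → - f v)      ≈⟨ ∑-cong m (λ v → sym (-1*x≈-x (f v))) ⟩
    ∑ m (λ v → - 1# * f v) ≈⟨ ∑-*ˡ m (- 1#) f ⟩
    - 1# * ∑ m f           ≈⟨ -1*x≈-x _ ⟩
    - ∑ m f                ∎

  ∑-comm : ∀ m k (f : Vec Bool m → Vec Bool k → Carrier) →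
    ∑ m (λ v → ∑ k (f v)) ≈ ∑ k (λ w → ∑ m (λ v → f v w))
  ∑-comm zero    k f = refl
  ∑-comm (suc m) k f = begin
    ∑ m (λ v → ∑ k (f (false ∷ v))) + ∑ m (λ v → ∑ k (f (true ∷ v)))
      ≈⟨ +-cong (∑-comm m k _) (∑-comm m k _) ⟩
    ∑ k (λ w → ∑ m (λ v → f (false ∷ v) w)) + ∑ k (λ w → ∑ m (λ v → f (true ∷ v) w))
      ≈⟨ ∑-+ k _ _ ⟨
    ∑ k (λ w → ∑ m (λ v → f (false ∷ v) w) + ∑ m (λ v → f (true ∷ v) w)) ∎

  ∑-single : ∀ m (u : Vec Bool m) {f : Vec Bool m → Carrier} →
    (∀ v → v ≢ u → f v ≈ 0#) → ∑ m f ≈ f u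
  ∑-single zero    []          f≈0 = refl
  ∑-single (suc m) (false ∷ u) f≈0 =
    trans (+-cong (∑-single m u (λ v v≢u → f≈0 (false ∷ v) (v≢u ∘ ∷-injectiveʳ)))
                  (∑-zero m (λ v → f≈0 (true ∷ v) λ ())))
          (+-identityʳ _)
  ∑-single (suc m) (true ∷ u)  f≈0 =
    trans (+-cong (∑-zero m (λ v → f≈0 (false ∷ v) λ ()))
                  (∑-single m u (λ v v≢u → f≈0 (true ∷ v) (v≢u ∘ ∷-injectiveʳ))))
          (+-identityˡ _)

  ∑ˢ : ∀ m → (Vec Bool m → Carrier) → Carrier
  ∑ˢ m f = ∑ m λ v → if sparse v then f v else 0#

  ∑ˢ-cong : ∀ m {f g : Vec Bool m → Carrier} →
    (∀ v → Sparse v → f v ≈ g v) → ∑ˢ m f ≈ ∑ˢ m g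
  ∑ˢ-cong m {f} {g} f≈g = ∑-cong m pointwise
    where
    pointwise : ∀ v → (if sparse v then f v else 0#) ≈ (if sparse v then g v else 0#)
    pointwise v with sparse v in v-sparse
    ... | true  = f≈g v v-sparse
    ... | false = refl

  ∑ˢ-*ˡ : ∀ m a (f : Vec Bool m → Carrier) → ∑ˢ m (λ v → a * f v) ≈ a * ∑ˢ m f
  ∑ˢ-*ˡ m a f = trans (∑-cong m pointwise) (∑-*ˡ m a _)
    where
    pointwise : ∀ v → (if sparse v then a * f v else 0#) ≈ a * (if sparse v then f v else 0#)
    pointwise v with sparse v
    ... | true  = refl
    ... | false = sym (zeroʳ a)

  ∑ˢ-*ʳ : ∀ m a (f : Vec Bool m → Carrier) → ∑ˢ m (λ v → f v * a) ≈ ∑ˢ m f * a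
  ∑ˢ-*ʳ m a f = begin
    ∑ˢ m (λ v → f v * a) ≈⟨ ∑ˢ-cong m (λ v _ → *-comm (f v) a) ⟩
    ∑ˢ m (λ v → a * f v) ≈⟨ ∑ˢ-*ˡ m a f ⟩
    a * ∑ˢ m f           ≈⟨ *-comm a _ ⟩
    ∑ˢ m f * a           ∎

  ∑ˢ-- : ∀ m (f g : Vec Bool m → Carrier) → ∑ˢ m (λ v → f v - g v) ≈ ∑ˢ m f - ∑ˢ m g
  ∑ˢ-- m f g = begin
    ∑ˢ m (λ v → f v - g v)
      ≈⟨ ∑-cong m pointwise ⟩
    ∑ m (λ v → (if sparse v then f v else 0#) - (if sparse v then g v else 0#))
      ≈⟨ ∑-+ m _ _ ⟩
    ∑ˢ m f + ∑ m (λ v → - (if sparse v then g v else 0#))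
      ≈⟨ +-cong refl (∑-neg m _) ⟩
    ∑ˢ m f - ∑ˢ m g ∎
    where
    pointwise : ∀ v → (if sparse v then f v - g v else 0#) ≈
                      (if sparse v then f v else 0#) - (if sparse v then g v else 0#)
    pointwise v with sparse v
    ... | true  = refl
    ... | false = sym (-‿inverseʳ 0#)

  ∑-if : ∀ b m (f : Vec Bool m → Carrier) →
    (if b then ∑ m f else 0#) ≈ ∑ m (λ v → if b then f v else 0#)
  ∑-if true  m f = refl
  ∑-if false m f = sym (∑-zero m (λ _ → refl))

  ∑ˢ-comm : ∀ m k (f : Vec Bool m → Vec Bool k → Carrier) →
    ∑ˢ m (λ v → ∑ˢ k (f v)) ≈ ∑ˢ k (λ w → ∑ˢ m (λ v → f v w))
  ∑ˢ-comm m k f = begin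
    ∑ˢ m (λ v → ∑ˢ k (f v))
      ≈⟨ ∑-cong m (λ v → ∑-if (sparse v) k _) ⟩
    ∑ m (λ v → ∑ k (λ w → if sparse v then (if sparse w then f v w else 0#) else 0#))
      ≈⟨ ∑-comm m k _ ⟩
    ∑ k (λ w → ∑ m (λ v → if sparse v then (if sparse w then f v w else 0#) else 0#))
      ≈⟨ ∑-cong k (λ w → ∑-cong m (λ v → if-swap (sparse v) (sparse w))) ⟩
    ∑ k (λ w → ∑ m (λ v → if sparse w then (if sparse v then f v w else 0#) else 0#))
      ≈⟨ ∑-cong k (λ w → ∑-if (sparse w) m _) ⟨
    ∑ˢ k (λ w → ∑ˢ m (λ v → f v w)) ∎
    where
    if-swap : ∀ a b {x} →
      (if a then (if b then x else 0#) else 0#) ≈ (if b then (if a then x else 0#) else 0#)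
    if-swap true  _     = refl
    if-swap false true  = refl
    if-swap false false = refl

  ∑ˢ-single : ∀ m {u : Vec Bool m} {f : Vec Bool m → Carrier} → Sparse u →
    (∀ v → Sparse v → v ≢ u → f v ≈ 0#) → ∑ˢ m f ≈ f u
  ∑ˢ-single m {u} {f} u-sparse f≈0 = begin
    ∑ˢ m f                          ≈⟨ ∑-single m u vanishes ⟩
    (if sparse u then f u else 0#)  ≡⟨ ≡.cong (if_then f u else 0#) u-sparse ⟩
    f u                             ∎
    where
    vanishes : ∀ v → v ≢ u → (if sparse v then f v else 0#) ≈ 0#
    vanishes v v≢u with sparse v in v-sparse
    ... | true  = f≈0 v v-sparse v≢u
    ... | false = refl

  -- Matrices are indexed by all of Vec Bool m, but only sparse indices take part:
  -- products sum over sparse indices and _≈ˢ_ compares sparse entries only.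
  Matrix : ℕ → Set c
  Matrix m = Vec Bool m → Vec Bool m → Carrier

  infixl 7 _⊛_ _⊙_

  _⊛_ : ∀ {m} → (Vec Bool m → Carrier) → Matrix m → Vec Bool m → Carrier
  _⊛_ {m} x A H = ∑ˢ m λ F → x F * A F H

  _⊙_ : ∀ {m} → Matrix m → Matrix m → Matrix m
  (A ⊙ B) F = A F ⊛ B

  𝕀 : ∀ {m} → Matrix m
  𝕀 F H = 𝟙 (eqV F H)

  infix 4 _≈ˢ_

  _≈ˢ_ : ∀ {m} → Matrix m → Matrix m → Set ℓ
  A ≈ˢ B = ∀ F H → Sparse F → Sparse H → A F H ≈ B F H

  ⊛-assoc : ∀ {m} (x : Vec Bool m → Carrier) (A B : Matrix m) H →
    (x ⊛ A ⊛ B) H ≈ (x ⊛ (A ⊙ B)) H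
  ⊛-assoc {m} x A B H = begin
    ∑ˢ m (λ G → ∑ˢ m (λ F → x F * A F G) * B G H)
      ≈⟨ ∑ˢ-cong m (λ G _ → ∑ˢ-*ʳ m _ _) ⟨
    ∑ˢ m (λ G → ∑ˢ m (λ F → x F * A F G * B G H))
      ≈⟨ ∑ˢ-comm m m _ ⟩
    ∑ˢ m (λ F → ∑ˢ m (λ G → x F * A F G * B G H))
      ≈⟨ ∑ˢ-cong m (λ F _ → ∑ˢ-cong m (λ G _ → *-assoc _ _ _)) ⟩
    ∑ˢ m (λ F → ∑ˢ m (λ G → x F * (A F G * B G H)))
      ≈⟨ ∑ˢ-cong m (λ F _ → ∑ˢ-*ˡ m _ _) ⟩
    ∑ˢ m (λ F → x F * ∑ˢ m (λ G → A F G * B G H)) ∎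

  𝕀-diagonal : ∀ {m} (F : Vec Bool m) → 𝕀 F F ≈ 1#
  𝕀-diagonal F = reflexive (≡.cong 𝟙 (eqV-refl F))

  𝕀-offDiagonal : ∀ {m} {F H : Vec Bool m} → F ≢ H → 𝕀 F H ≈ 0#
  𝕀-offDiagonal {F = F} {H} F≢H = reflexive (≡.cong 𝟙 (≢⇒eqV≡false F H F≢H))

  ⊛-identityʳ : ∀ {m} (x : Vec Bool m → Carrier) {H} → Sparse H → (x ⊛ 𝕀) H ≈ x H
  ⊛-identityʳ {m} x {H} H-sparse = begin
    ∑ˢ m (λ F → x F * 𝕀 F H)
      ≈⟨ ∑ˢ-single m H-sparse (λ F _ → y≈0⇒x*y≈0 (x F) ∘ 𝕀-offDiagonal) ⟩
    x H * 𝕀 H H              ≈⟨ *-cong refl (𝕀-diagonal H) ⟩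
    x H * 1#                 ≈⟨ *-identityʳ _ ⟩
    x H                      ∎

  𝕀-⊛ : ∀ {m} (A : Matrix m) {G} H → Sparse G → (𝕀 G ⊛ A) H ≈ A G H
  𝕀-⊛ {m} A {G} H G-sparse = begin
    ∑ˢ m (λ F → 𝕀 G F * A F H)
      ≈⟨ ∑ˢ-single m G-sparse (λ F _ → x≈0⇒x*y≈0 (A F H) ∘ 𝕀-offDiagonal ∘ (_∘ ≡.sym)) ⟩
    𝕀 G G * A G H ≈⟨ *-cong (𝕀-diagonal G) refl ⟩
    1# * A G H    ≈⟨ *-identityˡ _ ⟩
    A G H         ∎

  ⊛-congˡ : ∀ {m} {x y : Vec Bool m → Carrier} (A : Matrix m) H →
    (∀ F → Sparse F → x F ≈ y F) → (x ⊛ A) H ≈ (y ⊛ A) H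
  ⊛-congˡ {m} A H x≈y = ∑ˢ-cong m (λ F F-sparse → *-cong (x≈y F F-sparse) refl)

  ⊛-congʳ : ∀ {m} (x : Vec Bool m → Carrier) {A B : Matrix m} {H} → Sparse H →
    A ≈ˢ B → (x ⊛ A) H ≈ (x ⊛ B) H
  ⊛-congʳ {m} x H-sparse A≈B =
    ∑ˢ-cong m (λ F F-sparse → *-cong refl (A≈B F _ F-sparse H-sparse))

  IsLeftInverse : ∀ {m} → Matrix m → Matrix m → Set ℓ
  IsLeftInverse d A = d ⊙ A ≈ˢ 𝕀

  RowsIndependent : ∀ {m} → Matrix m → Set (c ⊔ ℓ)
  RowsIndependent A =
    ∀ x → (∀ H → Sparse H → (x ⊛ A) H ≈ 0#) → ∀ F → Sparse F → x F ≈ 0#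

  ⊛-leftInverse : ∀ {m} {d A : Matrix m} → IsLeftInverse d A →
    ∀ x {H} → Sparse H → (x ⊛ d ⊛ A) H ≈ x H
  ⊛-leftInverse {d = d} {A} d⊙A≈𝕀 x {H} H-sparse = begin
    (x ⊛ d ⊛ A) H   ≈⟨ ⊛-assoc x d A H ⟩
    (x ⊛ (d ⊙ A)) H ≈⟨ ⊛-congʳ x H-sparse d⊙A≈𝕀 ⟩
    (x ⊛ 𝕀) H       ≈⟨ ⊛-identityʳ x H-sparse ⟩
    x H             ∎

  ⊙-isLeftInverse : ∀ {m} {A U B d e : Matrix m} → B ≈ˢ A ⊙ U →
    IsLeftInverse d A → IsLeftInverse e U → IsLeftInverse (e ⊙ d) B
  ⊙-isLeftInverse {A = A} {U} {B} {d} {e} B≈A⊙U d⊙A≈𝕀 e⊙U≈𝕀 G H G-sparse H-sparse =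
    begin
    (e G ⊛ d ⊛ B) H   ≈⟨ ⊛-assoc (e G) d B H ⟩
    (e G ⊛ (d ⊙ B)) H ≈⟨ ⊛-congʳ (e G) H-sparse d⊙B≈U ⟩
    (e G ⊛ U) H       ≈⟨ e⊙U≈𝕀 G H G-sparse H-sparse ⟩
    𝕀 G H             ∎
    where
    d⊙B≈U : d ⊙ B ≈ˢ U
    d⊙B≈U F H F-sparse H-sparse = begin
      (d F ⊛ B) H       ≈⟨ ⊛-congʳ (d F) H-sparse B≈A⊙U ⟩
      (d F ⊛ (A ⊙ U)) H ≈⟨ ⊛-assoc (d F) A U H ⟨
      (d F ⊛ A ⊛ U) H   ≈⟨ ⊛-congˡ U H (λ G → d⊙A≈𝕀 F G F-sparse) ⟩
      (𝕀 F ⊛ U) H       ≈⟨ 𝕀-⊛ U H F-sparse ⟩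
      U F H             ∎

  ⊙-rowsIndependent : ∀ {m} {A U B : Matrix m} → B ≈ˢ A ⊙ U →
    RowsIndependent A → RowsIndependent U → RowsIndependent B
  ⊙-rowsIndependent {A = A} {U} {B} B≈A⊙U A-independent U-independent x x⊛B≈0 =
    A-independent x (U-independent (x ⊛ A) x⊛A⊛U≈0)
    where
    x⊛A⊛U≈0 : ∀ H → Sparse H → (x ⊛ A ⊛ U) H ≈ 0#
    x⊛A⊛U≈0 H H-sparse = begin
      (x ⊛ A ⊛ U) H   ≈⟨ ⊛-assoc x A U H ⟩
      (x ⊛ (A ⊙ U)) H ≈⟨ ⊛-congʳ x H-sparse B≈A⊙U ⟨
      (x ⊛ B) H       ≈⟨ x⊛B≈0 H H-sparse ⟩
      0#              ∎

  record Triangular {m} (w : Vec Bool m → ℕ) (A : Matrix m) : Set (c ⊔ ℓ) where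
    field
      diagonal⁻¹         : Vec Bool m → Carrier
      diagonal⁻¹-inverse : ∀ F → Sparse F → diagonal⁻¹ F * A F F ≈ 1#
      below-diagonal     : ∀ F F′ → Sparse F → Sparse F′ → F′ ≢ F →
                           A F F′ ≈ 0# ⊎ w F′ < w F

  module _ {m} {w : Vec Bool m → ℕ} {A : Matrix m} (T : Triangular w A) where
    open Triangular T

    offDiagonal : Matrix m
    offDiagonal G F = if eqV G F then 0# else A G F

    offDiagonal-support : ∀ G F → Sparse G → Sparse F →
      offDiagonal G F ≈ 0# ⊎ w F < w G
    offDiagonal-support G F G-sparse F-sparse with eqV G F in G≟F
    ... | true  = inj₁ refl
    ... | false = below-diagonal G F G-sparse F-sparse (eqV≡false⇒≢ G F G≟F ∘ ≡.sym)

    diagonal⁻¹-cancels : ∀ {G H} → Sparse H →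
      diagonal⁻¹ G * (A G H - offDiagonal G H) ≈ 𝕀 G H
    diagonal⁻¹-cancels {G} {H} H-sparse with eqV G H in G≟H
    ... | true rewrite eqV⇒≡ G H G≟H =
      trans (*-cong refl (trans (+-cong refl -0#≈0#) (+-identityʳ _)))
            (diagonal⁻¹-inverse H H-sparse)
    ... | false = trans (*-cong refl (-‿inverseʳ _)) (zeroʳ _)

    -- Back substitution: row G of the inverse is
    --   diagonal⁻¹ G * (𝕀 G - offDiagonal G ⊛ inverse),
    -- which only involves rows of smaller weight; k bounds the depth of the recursion.
    leftInverseUpTo : ℕ → Matrix m
    leftInverseUpTo zero    G F = 0#
    leftInverseUpTo (suc k) G F =
      diagonal⁻¹ G * (𝕀 G F - (offDiagonal G ⊛ leftInverseUpTo k) F)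

    leftInverseUpTo-correct : ∀ k {G H} → Sparse G → Sparse H → w G < k →
      (leftInverseUpTo k G ⊛ A) H ≈ 𝕀 G H
    leftInverseUpTo-correct (suc k) {G} {H} G-sparse H-sparse (s≤s wG≤k) = begin
      ∑ˢ m (λ F → u * (𝕀 G F - y F) * A F H)
        ≈⟨ ∑ˢ-cong m (λ F _ → *-assoc u _ _) ⟩
      ∑ˢ m (λ F → u * ((𝕀 G F - y F) * A F H))
        ≈⟨ ∑ˢ-*ˡ m u _ ⟩
      u * ∑ˢ m (λ F → (𝕀 G F - y F) * A F H)
        ≈⟨ *-cong refl (trans (∑ˢ-cong m (λ F _ → [y-z]x≈yx-zx _ _ _)) (∑ˢ-- m _ _)) ⟩
      u * ((𝕀 G ⊛ A) H - (offDiagonal G ⊛ leftInverseUpTo k ⊛ A) H)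
        ≈⟨ *-cong refl (+-cong (𝕀-⊛ A H G-sparse) (-‿cong (⊛-assoc _ _ A H))) ⟩
      u * (A G H - (offDiagonal G ⊛ (leftInverseUpTo k ⊙ A)) H)
        ≈⟨ *-cong refl (+-cong refl (-‿cong (∑ˢ-cong m lower-rows-inverted))) ⟩
      u * (A G H - (offDiagonal G ⊛ 𝕀) H)
        ≈⟨ *-cong refl (+-cong refl (-‿cong (⊛-identityʳ (offDiagonal G) H-sparse))) ⟩
      u * (A G H - offDiagonal G H)
        ≈⟨ diagonal⁻¹-cancels H-sparse ⟩
      𝕀 G H ∎
      where
      u = diagonal⁻¹ G
      y = (offDiagonal G ⊛ leftInverseUpTo k)
      lower-rows-inverted : ∀ F → Sparse F →
        offDiagonal G F * (leftInverseUpTo k ⊙ A) F H ≈ offDiagonal G F * 𝕀 F H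
      lower-rows-inverted F F-sparse with offDiagonal-support G F G-sparse F-sparse
      ... | inj₁ off≈0 = trans (x≈0⇒x*y≈0 _ off≈0) (sym (x≈0⇒x*y≈0 _ off≈0))
      ... | inj₂ wF<wG =
        *-cong refl (leftInverseUpTo-correct k F-sparse H-sparse (ℕₚ.<-≤-trans wF<wG wG≤k))

    leftInverse : Matrix m
    leftInverse G = leftInverseUpTo (suc (w G)) G

    leftInverse-isLeftInverse : IsLeftInverse leftInverse A
    leftInverse-isLeftInverse G H G-sparse H-sparse =
      leftInverseUpTo-correct (suc (w G)) G-sparse H-sparse ℕₚ.≤-refl

    -- Downward induction on the weight: the column of G only meets rows of larger weight.
    rowsIndependent : (N : ℕ) → (∀ F → w F < N) → RowsIndependent A
    rowsIndependent N w<N x x⊛A≈0 F F-sparse = vanishes N F-sparse (ℕₚ.m≤n+m N (w F))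
      where
      vanishes : ∀ j {G} → Sparse G → N ≤ w G ℕ.+ j → x G ≈ 0#
      vanishes zero {G} _ N≤wG+0 =
        contradiction (≡.subst (N ≤_) (ℕₚ.+-identityʳ (w G)) N≤wG+0) (ℕₚ.<⇒≱ (w<N G))
      vanishes (suc j) {G} G-sparse N≤wG+1+j = begin
        x G                         ≈⟨ *-identityʳ _ ⟨
        x G * 1#                    ≈⟨ *-cong refl (diagonal⁻¹-inverse G G-sparse) ⟨
        x G * (diagonal⁻¹ G * A G G) ≈⟨ x∙yz≈y∙xz _ _ _ ⟩
        diagonal⁻¹ G * (x G * A G G) ≈⟨ *-cong refl column ⟨
        diagonal⁻¹ G * (x ⊛ A) G    ≈⟨ *-cong refl (x⊛A≈0 G G-sparse) ⟩
        diagonal⁻¹ G * 0#           ≈⟨ zeroʳ _ ⟩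
        0#                          ∎
        where
        column : (x ⊛ A) G ≈ x G * A G G
        column = ∑ˢ-single m G-sparse heavier
          where
          heavier : ∀ F → Sparse F → F ≢ G → x F * A F G ≈ 0#
          heavier F F-sparse F≢G with below-diagonal F G F-sparse G-sparse (F≢G ∘ ≡.sym)
          ... | inj₁ AFG≈0 = y≈0⇒x*y≈0 (x F) AFG≈0
          ... | inj₂ wG<wF = x≈0⇒x*y≈0 (A F G) (vanishes j F-sparse N≤wF+j)
            where
            N≤wF+j = ℕₚ.≤-trans (≡.subst (N ≤_) (ℕₚ.+-suc (w G) j) N≤wG+1+j)
                                 (ℕₚ.+-monoˡ-≤ j wG<wF)

  sign : ∀ {m} → Vec Bool m → Carrier
  sign []          = 1#
  sign (true ∷ v)  = - sign v
  sign (false ∷ v) = sign v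

  sign-squared : ∀ {m} (v : Vec Bool m) → sign v * sign v ≈ 1#
  sign-squared []          = *-identityˡ 1#
  sign-squared (false ∷ v) = sign-squared v
  sign-squared (true ∷ v)  = begin
    - sign v * - sign v   ≈⟨ -‿distribˡ-* (sign v) (- sign v) ⟨
    - (sign v * - sign v) ≈⟨ -‿cong (-‿distribʳ-* (sign v) (sign v)) ⟨
    - - (sign v * sign v) ≈⟨ -‿involutive _ ⟩
    sign v * sign v       ≈⟨ sign-squared v ⟩
    1#                    ∎

  ζ : ∀ {m} → Matrix m
  ζ F H = 𝟙 (F ⊆ᵇ H)

  signedInclusion : ∀ {m} → (Vec Bool m → Vec Bool m) → Matrix m
  signedInclusion X F F′ = 𝟙 (F′ ⊆ᵇ X F) * sign F′

  disjointness : ∀ {m} → (Vec Bool m → Vec Bool m) → Matrix m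
  disjointness X F H = 𝟙 (disjoint H (X F))

  inclusion-exclusion : ∀ m (H Y : Vec Bool m) →
    ∑ m (λ F → 𝟙 (F ⊆ᵇ Y) * sign F * 𝟙 (F ⊆ᵇ H)) ≈ 𝟙 (disjoint H Y)
  inclusion-exclusion zero    []          []          = trans (*-identityʳ _) (*-identityˡ _)
  inclusion-exclusion (suc m) (false ∷ H) (false ∷ Y) =
    trans (+-cong (inclusion-exclusion m H Y) (∑-zero m (λ _ → x≈0⇒x*y≈0 _ (zeroˡ _))))
          (+-identityʳ _)
  inclusion-exclusion (suc m) (true ∷ H)  (false ∷ Y) =
    trans (+-cong (inclusion-exclusion m H Y) (∑-zero m (λ _ → x≈0⇒x*y≈0 _ (zeroˡ _))))
          (+-identityʳ _)
  inclusion-exclusion (suc m) (false ∷ H) (true ∷ Y)  =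
    trans (+-cong (inclusion-exclusion m H Y) (∑-zero m (λ _ → zeroʳ _)))
          (+-identityʳ _)
  inclusion-exclusion (suc m) (true ∷ H)  (true ∷ Y)  = begin
    S + ∑ m (λ F → 𝟙 (F ⊆ᵇ Y) * - sign F * 𝟙 (F ⊆ᵇ H))
      ≈⟨ +-cong refl (∑-cong m (λ F → *-cong (sym (-‿distribʳ-* _ _)) refl)) ⟩
    S + ∑ m (λ F → - (𝟙 (F ⊆ᵇ Y) * sign F) * 𝟙 (F ⊆ᵇ H))
      ≈⟨ +-cong refl (∑-cong m (λ F → sym (-‿distribˡ-* _ _))) ⟩
    S + ∑ m (λ F → - (𝟙 (F ⊆ᵇ Y) * sign F * 𝟙 (F ⊆ᵇ H)))
      ≈⟨ +-cong refl (∑-neg m _) ⟩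
    S - S
      ≈⟨ -‿inverseʳ S ⟩
    0# ∎
    where
    S = ∑ m (λ F → 𝟙 (F ⊆ᵇ Y) * sign F * 𝟙 (F ⊆ᵇ H))

  disjointness-factorization : ∀ {m} (X : Vec Bool m → Vec Bool m) →
    disjointness X ≈ˢ signedInclusion X ⊙ ζ
  disjointness-factorization {m} X F H _ H-sparse =
    sym (trans (∑-cong m subsets-of-H-are-sparse) (inclusion-exclusion m H (X F)))
    where
    subsets-of-H-are-sparse : ∀ F′ → (if sparse F′ then signedInclusion X F F′ * ζ F′ H else 0#)
                                     ≈ signedInclusion X F F′ * ζ F′ H
    subsets-of-H-are-sparse F′ with F′ ⊆ᵇ H in F′⊆H
    ... | true  = reflexive (≡.cong (if_then signedInclusion X F F′ * 1# else 0#)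
                                    (⊆-sparse F′ H F′⊆H H-sparse))
    ... | false with sparse F′
    ...   | true  = refl
    ...   | false = sym (zeroʳ _)

  -- ζ is upper triangular for lex, hence lower triangular for the reversed weight.
  ζ-triangular : ∀ {m} → Triangular (λ F → 2 ^ m ∸ lex F) (ζ {m})
  ζ-triangular {m} = record
    { diagonal⁻¹         = λ _ → 1#
    ; diagonal⁻¹-inverse = λ F _ → trans (*-identityˡ _) (reflexive (≡.cong 𝟙 (⊆-refl F)))
    ; below-diagonal     = below
    }
    where
    below : ∀ F F′ → Sparse F → Sparse F′ → F′ ≢ F →
      ζ F F′ ≈ 0# ⊎ 2 ^ m ∸ lex F′ < 2 ^ m ∸ lex F
    below F F′ _ _ F′≢F with F ⊆ᵇ F′ in F⊆F′
    ... | true  = inj₂ (ℕₚ.∸-monoʳ-< (⊂⇒lex< F F′ F⊆F′ (F′≢F ∘ ≡.sym))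
                                     (ℕₚ.<⇒≤ (lex<2^ F′)))
    ... | false = inj₁ refl

  module _ {m} {X : Vec Bool m → Vec Bool m} (X-lexMaximal : LexMaximal X) where
    open LexMaximal X-lexMaximal

    signedInclusion-triangular : Triangular lex (signedInclusion X)
    signedInclusion-triangular = record
      { diagonal⁻¹         = sign
      ; diagonal⁻¹-inverse = diagonal
      ; below-diagonal     = below
      }
      where
      diagonal : ∀ F → Sparse F → sign F * signedInclusion X F F ≈ 1#
      diagonal F _ rewrite ⊆-image F = trans (*-cong refl (*-identityˡ _)) (sign-squared F)
      below : ∀ F F′ → Sparse F → Sparse F′ → F′ ≢ F →
        signedInclusion X F F′ ≈ 0# ⊎ lex F′ < lex F
      below F F′ _ F′-sparse F′≢F with F′ ⊆ᵇ X F in F′⊆XF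
      ... | true  = inj₂ (sparse-⊆-image⇒lex< F F′ F′-sparse F′⊆XF F′≢F)
      ... | false = inj₁ (zeroˡ _)

    disjointness-isLeftInverse :
      IsLeftInverse (leftInverse ζ-triangular ⊙ leftInverse signedInclusion-triangular)
                    (disjointness X)
    disjointness-isLeftInverse = ⊙-isLeftInverse (disjointness-factorization X)
      (leftInverse-isLeftInverse signedInclusion-triangular)
      (leftInverse-isLeftInverse ζ-triangular)

    disjointness-rowsIndependent : RowsIndependent (disjointness X)
    disjointness-rowsIndependent = ⊙-rowsIndependent (disjointness-factorization X)
      (rowsIndependent signedInclusion-triangular (2 ^ m) lex<2^)
      (rowsIndependent ζ-triangular (suc (2 ^ m)) (λ F → s≤s (ℕₚ.m∸n≤m (2 ^ m) (lex F))))

module PeakBasis {c ℓ} (K : Field c ℓ) where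
  open Field K
  open GroupAlgebra K
  open SparseMatrices commutativeRing
  open import Relation.Binary.Reasoning.Setoid setoid

  sumV≡∑ : ∀ m f → sumV m f ≡ ∑ m f
  sumV≡∑ zero    f = ≡.refl
  sumV≡∑ (suc m) f = ≡.cong₂ _+_ (sumV≡∑ m _) (sumV≡∑ m _)

  P-offPeak : ∀ {n} (σ : Permutation′ n) G → G ≢ Peak σ → P G σ ≈ 0#
  P-offPeak σ G G≢Peakσ = 𝕀-offDiagonal (G≢Peakσ ∘ ≡.sym)

  comb-P : ∀ {n} coef (σ : Permutation′ n) → comb coef P σ ≈ coef (Peak σ)
  comb-P {n} coef σ = begin
    comb coef P σ                       ≡⟨ sumV≡∑ (n ∸ 1) _ ⟩
    ∑ˢ (n ∸ 1) (λ F → coef F * P F σ)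
      ≈⟨ ∑ˢ-single (n ∸ 1) (Peak-sparse σ) (λ F _ → y≈0⇒x*y≈0 _ ∘ P-offPeak σ F) ⟩
    coef (Peak σ) * 𝕀 (Peak σ) (Peak σ) ≈⟨ *-cong refl (𝕀-diagonal (Peak σ)) ⟩
    coef (Peak σ) * 1#                  ≈⟨ *-identityʳ _ ⟩
    coef (Peak σ)                       ∎

  O-apply : ∀ {n} (Y : Sub n) (σ : Permutation′ n) → O Y σ ≈ 𝟙 (disjoint (Peak σ) Y)
  O-apply {n} Y σ = begin
    O Y σ
      ≡⟨ sumV≡∑ (n ∸ 1) _ ⟩
    ∑ (n ∸ 1) (λ G → 𝟙 (sparse G ∧ disjoint G Y) * P G σ)
      ≈⟨ ∑-single (n ∸ 1) H (λ G → y≈0⇒x*y≈0 _ ∘ P-offPeak σ G) ⟩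
    𝟙 (sparse H ∧ disjoint H Y) * 𝕀 H H
      ≡⟨ ≡.cong (λ b → 𝟙 (b ∧ disjoint H Y) * 𝕀 H H) (Peak-sparse σ) ⟩
    𝟙 (disjoint H Y) * 𝕀 H H ≈⟨ *-cong refl (𝕀-diagonal H) ⟩
    𝟙 (disjoint H Y) * 1#    ≈⟨ *-identityʳ _ ⟩
    𝟙 (disjoint H Y)         ∎
    where H = Peak σ

  comb-O : ∀ {n} (X : Sub n → Sub n) coef (σ : Permutation′ n) →
    comb coef (O ∘ X) σ ≈ (coef ⊛ disjointness X) (Peak σ)
  comb-O {n} X coef σ = begin
    comb coef (O ∘ X) σ
      ≡⟨ sumV≡∑ (n ∸ 1) _ ⟩
    ∑ˢ (n ∸ 1) (λ F → coef F * O (X F) σ)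
      ≈⟨ ∑ˢ-cong (n ∸ 1) (λ F _ → *-cong refl (O-apply (X F) σ)) ⟩
    (coef ⊛ disjointness X) (Peak σ) ∎

  O∘-isPeakBasis : ∀ {n} {X : Sub n → Sub n} → LexMaximal X → IsPeakBasis (O ∘ X)
  O∘-isPeakBasis {n} {X} X-lexMaximal = inPeakAlgebra , independent , spanning
    where
    inPeakAlgebra : ∀ F → Sparse F → InPeakAlgebra (O (X F))
    inPeakAlgebra F _ = disjointness X F , λ σ → trans (O-apply (X F) σ) (sym (comb-P _ σ))

    independent : ∀ coef → comb coef (O ∘ X) ≋ (λ _ → 0#) →
      ∀ F → Sparse F → coef F ≈ 0#
    independent coef comb≈0 = disjointness-rowsIndependent X-lexMaximal coef columns-vanish
      where
      columns-vanish : ∀ H → Sparse H → (coef ⊛ disjointness X) H ≈ 0#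
      columns-vanish H H-sparse with Peak-surjective n H H-sparse
      ... | σ , ≡.refl = trans (sym (comb-O X coef σ)) (comb≈0 σ)

    spanning : ∀ x → InPeakAlgebra x → Σ (Sub n → Carrier) λ coef → x ≋ comb coef (O ∘ X)
    spanning x (coef , x≋) = coef ⊛ d , λ σ → begin
      x σ                                  ≈⟨ x≋ σ ⟩
      comb coef P σ                        ≈⟨ comb-P coef σ ⟩
      coef (Peak σ)                        ≈⟨ ⊛-leftInverse d-isLeftInverse coef (Peak-sparse σ) ⟨
      (coef ⊛ d ⊛ disjointness X) (Peak σ) ≈⟨ comb-O X (coef ⊛ d) σ ⟨
      comb (coef ⊛ d) (O ∘ X) σ            ∎
      where
      d = leftInverse ζ-triangular ⊙ leftInverse (signedInclusion-triangular X-lexMaximal)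
      d-isLeftInverse = disjointness-isLeftInverse X-lexMaximal

corollary1p7 : ∀ {c ℓ} (K : Field c ℓ) → CharNot2 K → (n : ℕ) →
    GroupAlgebra.IsPeakBasis K {n} (GroupAlgebra.O K)
    × GroupAlgebra.IsPeakBasis K {n} (GroupAlgebra.Ō K)
corollary1p7 K _ n = O∘-isPeakBasis id-lexMaximal , O∘-isPeakBasis bar-lexMaximal
  where open PeakBasis K
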